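{- For every $n\ge 4$, $pr(K_n,K_4^-)=\Big\lfloor\frac{3(n-1)}{2}\Big\rfloor$.
   Context: $K_4^-$ is the graph obtained from $K_4$ by deleting one edge. A subgraph of an edge-colored graph is properly colored if any two adjacent edges receive different colors. $pr(K_n,G)$ denotes the maximum number of colors in an (arbitrary) edge-coloring of the complete graph $K_n$ that contains no properly colored copy of $G$. -}

module Defs where

open import Data.Nat using (ℕ; _≤_; _*_; _∸_; _/_)
open import Data.Fin using (Fin; toℕ)
open import Data.Product using (_×_; Σ; ∃; ∃-syntax)
open import Relation.Nullary using (¬_)
open import Relation.Binary.PropositionalEquality using (_≡_; _≢_)
open import Function.Definitions using (Injective)

-- An edge-coloring of the complete graph K_n (vertex set Fin n) with colors Fin k:
-- the color of edge {i,j} (i ≢ j) is col i j; symmetry is required.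
-- Values on the diagonal are irrelevant.
record EdgeColoring (n k : ℕ) : Set where
  field
    col : Fin n → Fin n → Fin k
    sym : ∀ i j → col i j ≡ col j i

UsesAllColors : ∀ {n k} → EdgeColoring n k → Set
UsesAllColors {n} {k} c = ∀ (x : Fin k) → ∃[ i ] ∃[ j ] (i ≢ j × EdgeColoring.col c i j ≡ x)

-- K_4^- on vertex set Fin 4: K_4 minus the edge {2,3}.
K4⁻-edge : Fin 4 → Fin 4 → Set
K4⁻-edge u v = u ≢ v × ¬ (2 ≤ toℕ u × 2 ≤ toℕ v)

PCCopyK4⁻ : ∀ {n k} → EdgeColoring n k → Set
PCCopyK4⁻ {n} c = Σ (Fin 4 → Fin n) λ f → (Injective _≡_ _≡_ f ×
  (∀ (u v w : Fin 4) → K4⁻-edge u v → K4⁻-edge u w → v ≢ w →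
     EdgeColoring.col c (f u) (f v) ≢ EdgeColoring.col c (f u) (f w)))

Admissible : ℕ → ℕ → Set
Admissible n k = ∃[ c ] (UsesAllColors {n} {k} c × ¬ PCCopyK4⁻ c)

PrK4⁻ : ℕ → ℕ → Set
PrK4⁻ n m = Admissible n m × (∀ k → Admissible n k → k ≤ m)

module Submission where

-- Write h n for ⌊3(n-1)/2⌋: h 1 = 0, h 2 = 1 and h (n+2) = h n + 3, so vertex u ≥ 1
-- "owns" a block [h u, h (u+1)) of one or two colours, and two consecutive blocks never
-- both have two colours. A properly coloured K₄⁻ is handled as a Diamond: a spine edge ab
-- together with two vertices x, y joined to both a and b.
--
-- Lower bound: colour the edge {p, u} (p < u) with the last colour of u's block if p = u-1
-- and with its first colour otherwise. Every colour occurs, and the largest vertex of a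
-- diamond would need three colours at a vertex from below (impossible) or two (forcing a
-- predecessor with a one-colour block that sees everything below it alike).
--
-- Upper bound, by induction on n: if some vertex v has at most one private colour (one on
-- edges at v only), delete v, gaining h (n-1) + 1 ≤ h n. Otherwise a descent on colour
-- classes, driven by three forbidden diamond configurations, finds a colour on a single edge
-- vx; deleting v and x then loses at most three colours, and h (n-2) + 3 = h n.

open import Defs
open import Data.Nat
  using (ℕ; zero; suc; _+_; _*_; _∸_; _/_; _≤_; _<_; _≤′_; ≤′-refl; ≤′-step; z≤n; s≤s; _⊓_; _⊔_)
open import Data.Nat.Properties
open import Data.Nat.DivMod using (+-distrib-/-∣ˡ)
open import Data.Nat.Divisibility using (divides-refl)
open import Algebra.Properties.CommutativeSemigroup +-commutativeSemigroup using (interchange)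
open import Data.Fin using (Fin; zero; suc; toℕ; fromℕ<; punchIn; punchOut)
open import Data.Fin.Properties
  using (any?; all?; ¬∀⟶∃¬; toℕ-injective; toℕ-fromℕ<; toℕ<n; punchIn-injective; punchIn-punchOut)
  renaming (_≟_ to _≟ᶠ_; suc-injective to fsuc-injective)
open import Data.List using (List; []; _∷_; length)
open import Data.List.Membership.Propositional using (_∈_)
open import Data.List.Relation.Unary.Any using (here; there) renaming (any? to any∈?)
open import Data.Empty using (⊥; ⊥-elim)
open import Data.Sum using (_⊎_; inj₁; inj₂)
open import Data.Product using (∃-syntax; _×_; _,_; proj₁; proj₂)
open import Function using (_∘_)
open import Function.Definitions using (Injective)
open import Relation.Nullary using (¬_; Dec; yes; no; contradiction)
open import Relation.Nullary.Decidable using (_×-dec_; ¬?)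
open import Relation.Unary using (Decidable)
open import Relation.Binary.PropositionalEquality
open import Relation.Binary.Definitions using (tri<; tri≈; tri>)

h : ℕ → ℕ
h 0 = 0
h 1 = 0
h 2 = 1
h (suc (suc (suc n))) = 3 + h (suc n)

h-formula : ∀ n → h n ≡ 3 * (n ∸ 1) / 2
h-formula 0 = refl
h-formula 1 = refl
h-formula 2 = refl
h-formula (suc (suc (suc n))) = begin
  3 + h (suc n)    ≡⟨ cong (3 +_) (h-formula (suc n)) ⟩
  3 + 3 * n / 2    ≡⟨ +-distrib-/-∣ˡ (3 * n) {2} (divides-refl 3) ⟨
  (6 + 3 * n) / 2  ≡⟨ cong (_/ 2) (*-distribˡ-+ 3 2 n) ⟨
  3 * (2 + n) / 2  ∎
  where open ≡-Reasoning

h-step : ∀ n → h (suc (suc n)) ≡ 1 + h (suc n) ⊎ h (suc (suc n)) ≡ 2 + h (suc n)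
h-step zero = inj₁ refl
h-step (suc n) with h-step n
... | inj₁ one = inj₂ (cong (2 +_) (sym one))
... | inj₂ two = inj₁ (cong (1 +_) (sym two))

-- A two-colour step u → u+1 (signalled by h (u+1) - 1 ≠ h u) is preceded by a one-colour
-- step a → a+1 at a = u-1, provided a ≥ 1.
h-step-after-two : ∀ {a u} → suc a ≡ u → 1 ≤ a → h (suc u) ∸ 1 ≢ h u → h (suc a) ∸ 1 ≡ h a
h-step-after-two {suc a} refl _ two-at-u with h-step a
... | inj₁ one = cong (_∸ 1) one
... | inj₂ two = ⊥-elim (two-at-u (sym two))

h-strict : ∀ n → h (suc n) < h (suc (suc n))
h-strict n with h-step n
... | inj₁ one = ≤-reflexive (sym one)
... | inj₂ two = ≤-trans (n≤1+n _) (≤-reflexive (sym two))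

h-mono : ∀ {m n} → m ≤ n → h m ≤ h n
h-mono = go ∘ ≤⇒≤′
  where
  h-inc : ∀ n → h n ≤ h (suc n)
  h-inc zero = z≤n
  h-inc (suc n) = <⇒≤ (h-strict n)
  go : ∀ {m n} → m ≤′ n → h m ≤ h n
  go ≤′-refl = ≤-refl
  go (≤′-step {n} m≤′n) = ≤-trans (go m≤′n) (h-inc n)

indicator : ∀ {A : Set} → Dec A → ℕ
indicator (yes _) = 1
indicator (no _) = 0

count : ∀ {K} {P : Fin K → Set} → Decidable P → ℕ
count {zero} _ = 0
count {suc K} P? = indicator (P? zero) + count (P? ∘ suc)

count-none : ∀ {K} {P : Fin K → Set} (P? : Decidable P) → (∀ x → ¬ P x) → count P? ≡ 0
count-none {zero} P? none = refl
count-none {suc K} P? none with P? zero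
... | yes p = ⊥-elim (none zero p)
... | no _ = count-none (P? ∘ suc) (none ∘ suc)

count-all : ∀ {K} {P : Fin K → Set} (P? : Decidable P) → (∀ x → P x) → count P? ≡ K
count-all {zero} P? all = refl
count-all {suc K} P? all with P? zero
... | yes _ = cong suc (count-all (P? ∘ suc) (all ∘ suc))
... | no ¬p = ⊥-elim (¬p (all zero))

count-pos : ∀ {K} {P : Fin K → Set} (P? : Decidable P) → ∀ x → P x → 1 ≤ count P?
count-pos P? zero p with P? zero
... | yes _ = s≤s z≤n
... | no ¬p = ⊥-elim (¬p p)
count-pos P? (suc x) p = ≤-trans (count-pos (P? ∘ suc) x p) (m≤n+m _ (indicator (P? zero)))

count-≤1 : ∀ {K} {P : Fin K → Set} (P? : Decidable P) → (∀ x y → P x → P y → x ≡ y) → count P? ≤ 1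
count-≤1 {zero} P? unique = z≤n
count-≤1 {suc K} P? unique with P? zero
... | yes p = s≤s (≤-reflexive (count-none (P? ∘ suc) λ x q → 0≢suc (unique zero (suc x) p q)))
  where
  0≢suc : ∀ {x : Fin K} → zero ≢ suc x
  0≢suc ()
... | no _ = count-≤1 (P? ∘ suc) λ x y p q → fsuc-injective (unique (suc x) (suc y) p q)

indicator-mono : ∀ {A B : Set} (A? : Dec A) (B? : Dec B) → (A → B) → indicator A? ≤ indicator B?
indicator-mono (yes a) (yes _) _ = ≤-refl
indicator-mono (yes a) (no ¬b) f = ⊥-elim (¬b (f a))
indicator-mono (no _) B? _ = z≤n

indicator-∪ : ∀ {A B C : Set} (A? : Dec A) (B? : Dec B) (C? : Dec C) → (A → B ⊎ C) →
              indicator A? ≤ indicator B? + indicator C?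
indicator-∪ (no _) B? C? _ = z≤n
indicator-∪ (yes _) (yes _) C? _ = s≤s z≤n
indicator-∪ (yes _) (no _) (yes _) _ = s≤s z≤n
indicator-∪ (yes a) (no ¬b) (no ¬c) f with f a
... | inj₁ b = ⊥-elim (¬b b)
... | inj₂ c = ⊥-elim (¬c c)

count-mono : ∀ {K} {P Q : Fin K → Set} (P? : Decidable P) (Q? : Decidable Q) →
             (∀ x → P x → Q x) → count P? ≤ count Q?
count-mono {zero} P? Q? P⊆Q = z≤n
count-mono {suc K} P? Q? P⊆Q =
  +-mono-≤ (indicator-mono (P? zero) (Q? zero) (P⊆Q zero)) (count-mono (P? ∘ suc) (Q? ∘ suc) (P⊆Q ∘ suc))

count-< : ∀ {K} {P Q : Fin K → Set} (P? : Decidable P) (Q? : Decidable Q) →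
          (∀ x → P x → Q x) → ∀ z → Q z → ¬ P z → count P? < count Q?
count-< P? Q? P⊆Q zero q ¬p with P? zero | Q? zero
... | yes p | _ = ⊥-elim (¬p p)
... | no _ | yes _ = s≤s (count-mono (P? ∘ suc) (Q? ∘ suc) (P⊆Q ∘ suc))
... | no _ | no ¬q = ⊥-elim (¬q q)
count-< P? Q? P⊆Q (suc z) q ¬p =
  +-mono-≤-< (indicator-mono (P? zero) (Q? zero) (P⊆Q zero)) (count-< (P? ∘ suc) (Q? ∘ suc) (P⊆Q ∘ suc) z q ¬p)

count-∪ : ∀ {K} {P Q R : Fin K → Set} (P? : Decidable P) (Q? : Decidable Q) (R? : Decidable R) →
          (∀ x → P x → Q x ⊎ R x) → count P? ≤ count Q? + count R?
count-∪ {zero} P? Q? R? P⊆Q∪R = z≤n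
count-∪ {suc K} P? Q? R? P⊆Q∪R = begin
  indicator (P? zero) + count (P? ∘ suc)
    ≤⟨ +-mono-≤ (indicator-∪ (P? zero) (Q? zero) (R? zero) (P⊆Q∪R zero))
                (count-∪ (P? ∘ suc) (Q? ∘ suc) (R? ∘ suc) (P⊆Q∪R ∘ suc)) ⟩
  (indicator (Q? zero) + indicator (R? zero)) + (count (Q? ∘ suc) + count (R? ∘ suc))
    ≡⟨ interchange (indicator (Q? zero)) (indicator (R? zero)) (count (Q? ∘ suc)) (count (R? ∘ suc)) ⟩
  count Q? + count R?  ∎
  where open ≤-Reasoning

member? : ∀ {K} (xs : List (Fin K)) → Decidable (_∈ xs)
member? xs γ = any∈? (γ ≟ᶠ_) xs

count-∈ : ∀ {K} (xs : List (Fin K)) → count (member? xs) ≤ length xs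
count-∈ {K} [] = ≤-reflexive (count-none {K} (member? []) λ γ ())
count-∈ (y ∷ ys) = begin
  count (member? (y ∷ ys))               ≤⟨ count-∪ (member? (y ∷ ys)) (_≟ᶠ y) (member? ys) head-or-tail ⟩
  count (_≟ᶠ y) + count (member? ys)     ≤⟨ +-mono-≤ (count-≤1 (_≟ᶠ y) λ _ _ p q → trans p (sym q)) (count-∈ ys) ⟩
  suc (length ys)                        ∎
  where
  open ≤-Reasoning
  head-or-tail : ∀ γ → γ ∈ y ∷ ys → γ ≡ y ⊎ γ ∈ ys
  head-or-tail γ (here γ≡y) = inj₁ γ≡y
  head-or-tail γ (there γ∈ys) = inj₂ γ∈ys

module _ {n k : ℕ} (c : EdgeColoring n k) where
  open EdgeColoring c using (col)

  -- A properly coloured K₄⁻ spelled out: the edge ab is the spine, x and y are the two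
  -- vertices joined to both a and b (xy is the missing edge); at each vertex the edges
  -- present receive distinct colours.
  record Diamond (a b x y : Fin n) : Set where
    field
      a≢b : a ≢ b
      a≢x : a ≢ x
      a≢y : a ≢ y
      b≢x : b ≢ x
      b≢y : b ≢ y
      x≢y : x ≢ y
      a:bx : col a b ≢ col a x
      a:by : col a b ≢ col a y
      a:xy : col a x ≢ col a y
      b:ax : col b a ≢ col b x
      b:ay : col b a ≢ col b y
      b:xy : col b x ≢ col b y
      x:ab : col x a ≢ col x b
      y:ab : col y a ≢ col y b

  DiamondFree : Set
  DiamondFree = ∀ {a b x y} → ¬ Diamond a b x y

  diamond-swap-spine : ∀ {a b x y} → Diamond a b x y → Diamond b a x y
  diamond-swap-spine d = record
    { a≢b = ≢-sym a≢b ; a≢x = b≢x ; a≢y = b≢y ; b≢x = a≢x ; b≢y = a≢y ; x≢y = x≢y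
    ; a:bx = b:ax ; a:by = b:ay ; a:xy = b:xy ; b:ax = a:bx ; b:ay = a:by ; b:xy = a:xy
    ; x:ab = ≢-sym x:ab ; y:ab = ≢-sym y:ab }
    where open Diamond d

  diamond-swap-legs : ∀ {a b x y} → Diamond a b x y → Diamond a b y x
  diamond-swap-legs d = record
    { a≢b = a≢b ; a≢x = a≢y ; a≢y = a≢x ; b≢x = b≢y ; b≢y = b≢x ; x≢y = ≢-sym x≢y
    ; a:bx = a:by ; a:by = a:bx ; a:xy = ≢-sym a:xy ; b:ax = b:ay ; b:ay = b:ax ; b:xy = ≢-sym b:xy
    ; x:ab = y:ab ; y:ab = x:ab }
    where open Diamond d

  pattern v₀ = zero
  pattern v₁ = suc zero
  pattern v₂ = suc (suc zero)
  pattern v₃ = suc (suc (suc zero))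

  copy⇒diamond : PCCopyK4⁻ c → ∃[ a ] ∃[ b ] ∃[ x ] ∃[ y ] Diamond a b x y
  copy⇒diamond (f , f-inj , proper) = f v₀ , f v₁ , f v₂ , f v₃ , record
    { a≢b = (λ ()) ∘ f-inj ; a≢x = (λ ()) ∘ f-inj ; a≢y = (λ ()) ∘ f-inj
    ; b≢x = (λ ()) ∘ f-inj ; b≢y = (λ ()) ∘ f-inj ; x≢y = (λ ()) ∘ f-inj
    ; a:bx = proper v₀ v₁ v₂ e₀₁ e₀₂ (λ ())
    ; a:by = proper v₀ v₁ v₃ e₀₁ e₀₃ (λ ())
    ; a:xy = proper v₀ v₂ v₃ e₀₂ e₀₃ (λ ())
    ; b:ax = proper v₁ v₀ v₂ e₁₀ e₁₂ (λ ())
    ; b:ay = proper v₁ v₀ v₃ e₁₀ e₁₃ (λ ())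
    ; b:xy = proper v₁ v₂ v₃ e₁₂ e₁₃ (λ ())
    ; x:ab = proper v₂ v₀ v₁ e₂₀ e₂₁ (λ ())
    ; y:ab = proper v₃ v₀ v₁ e₃₀ e₃₁ (λ ()) }
    where
    e₀₁ : K4⁻-edge v₀ v₁
    e₀₁ = (λ ()) , λ { (() , _) }
    e₀₂ : K4⁻-edge v₀ v₂
    e₀₂ = (λ ()) , λ { (() , _) }
    e₀₃ : K4⁻-edge v₀ v₃
    e₀₃ = (λ ()) , λ { (() , _) }
    e₁₀ : K4⁻-edge v₁ v₀
    e₁₀ = (λ ()) , λ { (s≤s () , _) }
    e₁₂ : K4⁻-edge v₁ v₂
    e₁₂ = (λ ()) , λ { (s≤s () , _) }
    e₁₃ : K4⁻-edge v₁ v₃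
    e₁₃ = (λ ()) , λ { (s≤s () , _) }
    e₂₀ : K4⁻-edge v₂ v₀
    e₂₀ = (λ ()) , λ { (_ , ()) }
    e₂₁ : K4⁻-edge v₂ v₁
    e₂₁ = (λ ()) , λ { (_ , s≤s ()) }
    e₃₀ : K4⁻-edge v₃ v₀
    e₃₀ = (λ ()) , λ { (_ , ()) }
    e₃₁ : K4⁻-edge v₃ v₁
    e₃₁ = (λ ()) , λ { (_ , s≤s ()) }

  diamond⇒copy : ∀ {a b x y} → Diamond a b x y → PCCopyK4⁻ c
  diamond⇒copy {a} {b} {x} {y} d = f , f-injective , proper
    where
    open Diamond d
    f : Fin 4 → Fin n
    f v₀ = a
    f v₁ = b
    f v₂ = x
    f v₃ = y

    f-injective : Injective _≡_ _≡_ f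
    f-injective {v₀} {v₀} _ = refl
    f-injective {v₁} {v₁} _ = refl
    f-injective {v₂} {v₂} _ = refl
    f-injective {v₃} {v₃} _ = refl
    f-injective {v₀} {v₁} e = ⊥-elim (a≢b e)
    f-injective {v₀} {v₂} e = ⊥-elim (a≢x e)
    f-injective {v₀} {v₃} e = ⊥-elim (a≢y e)
    f-injective {v₁} {v₂} e = ⊥-elim (b≢x e)
    f-injective {v₁} {v₃} e = ⊥-elim (b≢y e)
    f-injective {v₂} {v₃} e = ⊥-elim (x≢y e)
    f-injective {v₁} {v₀} e = ⊥-elim (a≢b (sym e))
    f-injective {v₂} {v₀} e = ⊥-elim (a≢x (sym e))
    f-injective {v₃} {v₀} e = ⊥-elim (a≢y (sym e))
    f-injective {v₂} {v₁} e = ⊥-elim (b≢x (sym e))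
    f-injective {v₃} {v₁} e = ⊥-elim (b≢y (sym e))
    f-injective {v₃} {v₂} e = ⊥-elim (x≢y (sym e))

    not-edge : ∀ {u w} → 2 ≤ toℕ u → 2 ≤ toℕ w → ¬ K4⁻-edge u w
    not-edge 2≤u 2≤w (_ , not-both) = not-both (2≤u , 2≤w)

    irrefl : ∀ {u} → ¬ K4⁻-edge u u
    irrefl (u≢u , _) = u≢u refl

    2≤2 : 2 ≤ 2
    2≤2 = s≤s (s≤s z≤n)
    2≤3 : 2 ≤ 3
    2≤3 = s≤s (s≤s z≤n)

    proper : ∀ (u v w : Fin 4) → K4⁻-edge u v → K4⁻-edge u w → v ≢ w →
             col (f u) (f v) ≢ col (f u) (f w)
    proper v₀ v₁ v₂ _ _ _ = a:bx
    proper v₀ v₁ v₃ _ _ _ = a:by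
    proper v₀ v₂ v₃ _ _ _ = a:xy
    proper v₀ v₂ v₁ _ _ _ = ≢-sym a:bx
    proper v₀ v₃ v₁ _ _ _ = ≢-sym a:by
    proper v₀ v₃ v₂ _ _ _ = ≢-sym a:xy
    proper v₁ v₀ v₂ _ _ _ = b:ax
    proper v₁ v₀ v₃ _ _ _ = b:ay
    proper v₁ v₂ v₃ _ _ _ = b:xy
    proper v₁ v₂ v₀ _ _ _ = ≢-sym b:ax
    proper v₁ v₃ v₀ _ _ _ = ≢-sym b:ay
    proper v₁ v₃ v₂ _ _ _ = ≢-sym b:xy
    proper v₂ v₀ v₁ _ _ _ = x:ab
    proper v₂ v₁ v₀ _ _ _ = ≢-sym x:ab
    proper v₃ v₀ v₁ _ _ _ = y:ab
    proper v₃ v₁ v₀ _ _ _ = ≢-sym y:ab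
    proper v₀ v₀ _ uv _ _ = ⊥-elim (irrefl uv)
    proper v₁ v₁ _ uv _ _ = ⊥-elim (irrefl uv)
    proper v₂ v₂ _ uv _ _ = ⊥-elim (irrefl uv)
    proper v₃ v₃ _ uv _ _ = ⊥-elim (irrefl uv)
    proper v₀ _ v₀ _ uw _ = ⊥-elim (irrefl uw)
    proper v₁ _ v₁ _ uw _ = ⊥-elim (irrefl uw)
    proper v₂ _ v₂ _ uw _ = ⊥-elim (irrefl uw)
    proper v₃ _ v₃ _ uw _ = ⊥-elim (irrefl uw)
    proper _ v₀ v₀ _ _ v≢w = ⊥-elim (v≢w refl)
    proper _ v₁ v₁ _ _ v≢w = ⊥-elim (v≢w refl)
    proper _ v₂ v₂ _ _ v≢w = ⊥-elim (v≢w refl)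
    proper _ v₃ v₃ _ _ v≢w = ⊥-elim (v≢w refl)
    proper v₂ v₃ _ uv _ _ = ⊥-elim (not-edge 2≤2 2≤3 uv)
    proper v₃ v₂ _ uv _ _ = ⊥-elim (not-edge 2≤3 2≤2 uv)
    proper v₂ _ v₃ _ uw _ = ⊥-elim (not-edge 2≤2 2≤3 uw)
    proper v₃ _ v₂ _ uw _ = ⊥-elim (not-edge 2≤3 2≤2 uw)

-- The extremal colouring on ℕ: for p < u the edge {p, u} gets the last colour of u's
-- block [h u, h (u+1)) if p is the predecessor of u, and the first colour h u otherwise.
down : ℕ → ℕ → ℕ
down p u with suc p ≟ u
... | yes _ = h (suc u) ∸ 1
... | no _ = h u

down-pred : ∀ {p u} → suc p ≡ u → down p u ≡ h (suc u) ∸ 1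
down-pred {p} {u} sp≡u with suc p ≟ u
... | yes _ = refl
... | no sp≢u = contradiction sp≡u sp≢u

down-other : ∀ {p u} → suc p ≢ u → down p u ≡ h u
down-other {p} {u} sp≢u with suc p ≟ u
... | yes sp≡u = contradiction sp≡u sp≢u
... | no _ = refl

down-uniform : ∀ p u → h (suc u) ∸ 1 ≡ h u → down p u ≡ h u
down-uniform p u one with suc p ≟ u
... | yes _ = one
... | no _ = refl

down<h : ∀ {p u n} → 2 ≤ n → u < n → down p u < h n
down<h {p} {u} {n} 2≤n u<n with suc p ≟ u
... | yes refl = ≤-trans (∸-monoʳ-< (s≤s z≤n) (h-mono {2} {suc (suc p)} (s≤s (s≤s z≤n)))) (h-mono u<n)
... | no _ = h<h u u<n
  where
  h<h : ∀ u → u < n → h u < h n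
  h<h zero _ = h-mono 2≤n
  h<h (suc u) u<n = ≤-trans (h-strict u) (h-mono u<n)

block-of : ∀ n Y → Y < h n → ∃[ u ] (1 ≤ u × u < n × h u ≤ Y × Y < h (suc u))
block-of zero Y ()
block-of (suc zero) Y ()
block-of (suc (suc n)) Y Y<h with Y <? h (suc n) | block-of (suc n) Y
... | no Y≮h′ | _ = suc n , s≤s z≤n , ≤-refl , ≮⇒≥ Y≮h′ , Y<h
... | yes Y<h′ | earlier with earlier Y<h′
...   | u , 1≤u , u<n , block = u , 1≤u , m<n⇒m<1+n u<n , block

block-realised : ∀ {u Y} → 1 ≤ u → h u ≤ Y → Y < h (suc u) → ∃[ p ] (p < u × down p u ≡ Y)
block-realised {suc u} {Y} _ lo hi with h-step u
... | inj₁ one = u , ≤-refl , (begin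
  down u (suc u)         ≡⟨ down-pred {u} refl ⟩
  h (suc (suc u)) ∸ 1    ≡⟨ cong (_∸ 1) one ⟩
  h (suc u)              ≡⟨ ≤-antisym lo (≤-pred (subst (Y <_) one hi)) ⟩
  Y                      ∎)
  where open ≡-Reasoning
... | inj₂ two with Y ≟ h (suc u)
-- the first colour of a two-colour block: u ≥ 2, so the edge {0, u} carries it
...   | yes Y≡first = 0 , s≤s z≤n ,
        trans (down-other {0} {suc u} λ { refl → contradiction two λ () }) (sym Y≡first)
...   | no Y≢first = u , ≤-refl , (begin
  down u (suc u)         ≡⟨ down-pred {u} refl ⟩
  h (suc (suc u)) ∸ 1    ≡⟨ cong (_∸ 1) two ⟩
  suc (h (suc u))        ≡⟨ ≤-antisym (≤∧≢⇒< lo (≢-sym Y≢first)) (≤-pred (subst (Y <_) two hi)) ⟩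
  Y                      ∎)
  where open ≡-Reasoning

module ExtremalColouring (n : ℕ) (2≤n : 2 ≤ n) where

  colour : Fin n → Fin n → Fin (h n)
  colour i j = fromℕ< (down<h {toℕ i ⊓ toℕ j} 2≤n (⊔-lub (toℕ<n i) (toℕ<n j)))

  colour-toℕ : ∀ i j → toℕ (colour i j) ≡ down (toℕ i ⊓ toℕ j) (toℕ i ⊔ toℕ j)
  colour-toℕ i j = toℕ-fromℕ< _

  colouring : EdgeColoring n (h n)
  colouring = record { col = colour ; sym = colour-sym }
    where
    colour-sym : ∀ i j → colour i j ≡ colour j i
    colour-sym i j = toℕ-injective (begin
      toℕ (colour i j)                           ≡⟨ colour-toℕ i j ⟩
      down (toℕ i ⊓ toℕ j) (toℕ i ⊔ toℕ j)       ≡⟨ cong₂ down (⊓-comm (toℕ i) _) (⊔-comm (toℕ i) _) ⟩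
      down (toℕ j ⊓ toℕ i) (toℕ j ⊔ toℕ i)       ≡⟨ colour-toℕ j i ⟨
      toℕ (colour j i)                           ∎)
      where open ≡-Reasoning

  colour-down : ∀ {u p} → toℕ p < toℕ u → toℕ (colour u p) ≡ down (toℕ p) (toℕ u)
  colour-down {u} {p} p<u =
    trans (colour-toℕ u p) (cong₂ down (m≥n⇒m⊓n≡n (<⇒≤ p<u)) (m≥n⇒m⊔n≡m (<⇒≤ p<u)))

  colour-eq : ∀ {u p q} → toℕ p < toℕ u → toℕ q < toℕ u →
              down (toℕ p) (toℕ u) ≡ down (toℕ q) (toℕ u) → colour u p ≡ colour u q
  colour-eq p<u q<u e = toℕ-injective (trans (colour-down p<u) (trans e (sym (colour-down q<u))))

  unique-pred : ∀ {u p q : Fin n} → suc (toℕ p) ≡ toℕ u → q ≢ p → suc (toℕ q) ≢ toℕ u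
  unique-pred sp≡u q≢p sq≡u = q≢p (toℕ-injective (suc-injective (trans sq≡u (sym sp≡u))))

  same-colour-below : ∀ {u p q} → toℕ p < toℕ u → toℕ q < toℕ u →
                      suc (toℕ p) ≢ toℕ u → suc (toℕ q) ≢ toℕ u → colour u p ≡ colour u q
  same-colour-below p<u q<u p-not-pred q-not-pred =
    colour-eq p<u q<u (trans (down-other p-not-pred) (sym (down-other q-not-pred)))

  no-rainbow-star : ∀ {u p q r} → toℕ p < toℕ u → toℕ q < toℕ u → toℕ r < toℕ u →
                    p ≢ q → p ≢ r → q ≢ r →
                    colour u p ≢ colour u q → colour u p ≢ colour u r → colour u q ≢ colour u r → ⊥
  no-rainbow-star {u} {p} {q} {r} p<u q<u r<u p≢q p≢r q≢r pq pr qr with suc (toℕ p) ≟ toℕ u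
  ... | yes p-pred = qr (same-colour-below q<u r<u (unique-pred p-pred (≢-sym p≢q)) (unique-pred p-pred (≢-sym p≢r)))
  ... | no p-not-pred with suc (toℕ q) ≟ toℕ u
  ...   | yes q-pred = pr (same-colour-below p<u r<u p-not-pred (unique-pred q-pred (≢-sym q≢r)))
  ...   | no q-not-pred = pq (same-colour-below p<u q<u p-not-pred q-not-pred)

  -- If u sees its predecessor a and another smaller vertex b in different colours, then u has a
  -- two-colour block, so a has a one-colour block and sees b and any y below u alike.
  predecessor-fan : ∀ {u a b y} → suc (toℕ a) ≡ toℕ u → toℕ b < toℕ u → toℕ y < toℕ u →
                    b ≢ a → y ≢ a → colour u a ≢ colour u b → colour a b ≢ colour a y → ⊥
  predecessor-fan {u} {a} {b} {y} a-pred b<u y<u b≢a y≢a ua≢ub ab≢ay =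
    ab≢ay (colour-eq b<a y<a (trans (down-uniform (toℕ b) (toℕ a) a-one) (sym (down-uniform (toℕ y) (toℕ a) a-one))))
    where
    below-a : ∀ {z} → toℕ z < toℕ u → z ≢ a → toℕ z < toℕ a
    below-a z<u z≢a = ≤∧≢⇒< (≤-pred (subst (_ <_) (sym a-pred) z<u)) (z≢a ∘ toℕ-injective)
    b<a : toℕ b < toℕ a
    b<a = below-a b<u b≢a
    y<a : toℕ y < toℕ a
    y<a = below-a y<u y≢a
    u-two : h (suc (toℕ u)) ∸ 1 ≢ h (toℕ u)
    u-two e = ua≢ub (colour-eq (≤-reflexive a-pred) b<u
                (trans (down-pred a-pred) (trans e (sym (down-other (unique-pred a-pred b≢a))))))
    a-one : h (suc (toℕ a)) ∸ 1 ≡ h (toℕ a)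
    a-one = h-step-after-two a-pred (≤-trans (s≤s z≤n) b<a) u-two

  no-rainbow-fan : ∀ {u a b y} → toℕ a < toℕ u → toℕ b < toℕ u → toℕ y < toℕ u →
                   a ≢ b → a ≢ y → b ≢ y →
                   colour u a ≢ colour u b → colour a b ≢ colour a y → colour b a ≢ colour b y → ⊥
  no-rainbow-fan {u} {a} {b} {y} a<u b<u y<u a≢b a≢y b≢y ua≢ub ab≢ay ba≢by with suc (toℕ a) ≟ toℕ u
  ... | yes a-pred = predecessor-fan a-pred b<u y<u (≢-sym a≢b) (≢-sym a≢y) ua≢ub ab≢ay
  ... | no a-not-pred with suc (toℕ b) ≟ toℕ u
  ...   | yes b-pred = predecessor-fan b-pred a<u y<u a≢b (≢-sym b≢y) (≢-sym ua≢ub) ba≢by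
  ...   | no b-not-pred = ua≢ub (same-colour-below a<u b<u a-not-pred b-not-pred)

  -- A diamond whose spine is ordered b < a and whose legs are ordered y < x: its largest
  -- vertex is a (a rainbow star) or x (a rainbow fan).
  no-ordered-diamond : ∀ {a b x y} → toℕ b < toℕ a → toℕ y < toℕ x → ¬ Diamond colouring a b x y
  no-ordered-diamond {a} {b} {x} {y} b<a y<x d with <-cmp (toℕ a) (toℕ x)
  ... | tri> _ _ x<a = no-rainbow-star b<a x<a (<-trans y<x x<a) b≢x b≢y x≢y a:bx a:by a:xy
    where open Diamond d
  ... | tri< a<x _ _ = no-rainbow-fan a<x (<-trans b<a a<x) y<x a≢b a≢y b≢y x:ab a:by b:ay
    where open Diamond d
  ... | tri≈ _ a≡x _ = Diamond.a≢x d (toℕ-injective a≡x)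

  diamond-free : DiamondFree colouring
  diamond-free {a} {b} {x} {y} d with <-cmp (toℕ a) (toℕ b) | <-cmp (toℕ x) (toℕ y)
  ... | tri≈ _ a≡b _ | _ = Diamond.a≢b d (toℕ-injective a≡b)
  ... | _ | tri≈ _ x≡y _ = Diamond.x≢y d (toℕ-injective x≡y)
  ... | tri> _ _ b<a | tri> _ _ y<x = no-ordered-diamond b<a y<x d
  ... | tri> _ _ b<a | tri< x<y _ _ = no-ordered-diamond b<a x<y (diamond-swap-legs colouring d)
  ... | tri< a<b _ _ | tri> _ _ y<x = no-ordered-diamond a<b y<x (diamond-swap-spine colouring d)
  ... | tri< a<b _ _ | tri< x<y _ _ =
    no-ordered-diamond a<b x<y (diamond-swap-legs colouring (diamond-swap-spine colouring d))

  all-colours : UsesAllColors colouring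
  all-colours γ with block-of n (toℕ γ) (toℕ<n γ)
  ... | u , 1≤u , u<n , lo , hi with block-realised 1≤u lo hi
  ...   | p , p<u , down≡γ = j , i , i≢j ∘ sym , toℕ-injective (begin
    toℕ (colour j i)         ≡⟨ colour-down (subst₂ _<_ (sym toℕ-i) (sym toℕ-j) p<u) ⟩
    down (toℕ i) (toℕ j)     ≡⟨ cong₂ down toℕ-i toℕ-j ⟩
    down p u                 ≡⟨ down≡γ ⟩
    toℕ γ                    ∎)
    where
    open ≡-Reasoning
    i j : Fin n
    i = fromℕ< (<-trans p<u u<n)
    j = fromℕ< u<n
    toℕ-i : toℕ i ≡ p
    toℕ-i = toℕ-fromℕ< _
    toℕ-j : toℕ j ≡ u
    toℕ-j = toℕ-fromℕ< _
    i≢j : i ≢ j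
    i≢j i≡j = <⇒≢ p<u (trans (sym toℕ-i) (trans (cong toℕ i≡j) toℕ-j))

Used : ∀ {n k} → EdgeColoring n k → Fin k → Set
Used c γ = ∃[ i ] ∃[ j ] (i ≢ j × EdgeColoring.col c i j ≡ γ)

used? : ∀ {n k} (c : EdgeColoring n k) → Decidable (Used c)
used? c γ = any? λ i → any? λ j → ¬? (i ≟ᶠ j) ×-dec (EdgeColoring.col c i j ≟ᶠ γ)

#colours : ∀ {n k} → EdgeColoring n k → ℕ
#colours c = count (used? c)

module ColourClasses {m K : ℕ} (c : EdgeColoring m K) where
  open EdgeColoring c using (col) renaming (sym to col-sym)

  col-flip : ∀ {a b γ} → col a b ≡ γ → col b a ≡ γ
  col-flip {a} {b} ab≡γ = trans (col-sym b a) ab≡γ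

  differ : ∀ {a b a′ b′ p q} → col a b ≡ p → col a′ b′ ≡ q → p ≢ q → col a b ≢ col a′ b′
  differ ab≡p a′b′≡q p≢q e = p≢q (trans (sym ab≡p) (trans e a′b′≡q))

  differ′ : ∀ {a b a′ b′ p} → col a b ≡ p → col a′ b′ ≢ p → col a b ≢ col a′ b′
  differ′ ab≡p a′b′≢p e = a′b′≢p (trans (sym e) ab≡p)

  Private : Fin m → Fin K → Set
  Private v α = Used c α × (∀ {i j} → i ≢ j → col i j ≡ α → i ≡ v ⊎ j ≡ v)

  private-edge : ∀ {v α} → Private v α → ∃[ w ] (w ≢ v × col v w ≡ α)
  private-edge ((i , j , i≢j , ij≡α) , at-v) with at-v i≢j ij≡α
  ... | inj₁ refl = j , ≢-sym i≢j , ij≡α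
  ... | inj₂ refl = i , i≢j , col-flip ij≡α

  private-avoids : ∀ {v α i j} → Private v α → i ≢ j → i ≢ v → j ≢ v → col i j ≢ α
  private-avoids (_ , at-v) i≢j i≢v j≢v ij≡α with at-v i≢j ij≡α
  ... | inj₁ i≡v = i≢v i≡v
  ... | inj₂ j≡v = j≢v j≡v

  Nbr : Fin m → Fin K → Fin m → Set
  Nbr v α w = w ≢ v × col v w ≡ α

  nbr? : ∀ v α → Decidable (Nbr v α)
  nbr? v α w = ¬? (w ≟ᶠ v) ×-dec (col v w ≟ᶠ α)

  nbr-≢ : ∀ {v x w α ε} → col v x ≡ α → col x w ≡ ε → ε ≢ α → w ≢ v
  nbr-≢ vx≡α xw≡ε ε≢α refl = ε≢α (trans (sym xw≡ε) (col-flip vx≡α))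

  record Link (v x : Fin m) (β ε : Fin K) : Set where
    constructor link
    field
      t : Fin m
      t≢v : t ≢ v
      t≢x : t ≢ x
      vt : col v t ≡ β
      xt : col x t ≡ ε

  link-swap : ∀ {v x β ε} → Link v x β ε → Link x v ε β
  link-swap (link t t≢v t≢x vt xt) = link t t≢x t≢v xt vt

  SingleEdge : Fin m → Fin m → Fin K → Set
  SingleEdge v x α = v ≢ x × col v x ≡ α × Private v α × Private x α

  Avoids : Fin m → Fin m → Fin K → Set
  Avoids v x γ = ∀ {i j} → i ≢ j → i ≢ v → i ≢ x → j ≢ v → j ≢ x → col i j ≢ γ

  avoids-swap : ∀ {v x γ} → Avoids v x γ → Avoids x v γ
  avoids-swap avoids i≢j i≢x i≢v j≢x j≢v = avoids i≢j i≢v i≢x j≢v j≢x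

  avoids-meets : ∀ {v x γ} → Used c γ → Avoids v x γ →
                 (∃[ w ] (w ≢ v × col v w ≡ γ)) ⊎ (∃[ w ] (w ≢ x × col x w ≡ γ))
  avoids-meets {v} {x} (i , j , i≢j , ij≡γ) avoids with i ≟ᶠ v | i ≟ᶠ x | j ≟ᶠ v | j ≟ᶠ x
  ... | yes refl | _ | _ | _ = inj₁ (j , ≢-sym i≢j , ij≡γ)
  ... | no _ | yes refl | _ | _ = inj₂ (j , ≢-sym i≢j , ij≡γ)
  ... | no _ | no _ | yes refl | _ = inj₁ (i , i≢j , col-flip ij≡γ)
  ... | no _ | no _ | no _ | yes refl = inj₂ (i , i≢j , col-flip ij≡γ)
  ... | no i≢v | no i≢x | no j≢v | no j≢x = ⊥-elim (avoids i≢j i≢v i≢x j≢v j≢x ij≡γ)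

module DiamondFreeColouring {m K : ℕ} (c : EdgeColoring m K) (free : DiamondFree c) where
  open EdgeColoring c using (col)
  open ColourClasses c

  -- If x has an
  -- ε-neighbour w with c(vw) ≠ α, then v and x are linked by colours β and ε: otherwise
  -- v, x (spine), a β-neighbour t of v and w would span a diamond.
  common-neighbour : ∀ {v x w α β ε} → Private v α → Private v β → Private x ε → β ≢ α → ε ≢ α →
                     v ≢ x → col v x ≡ α → w ≢ x → col x w ≡ ε → col v w ≢ α → Link v x β ε
  common-neighbour {v} {x} {w} {_} {β} {ε} Pα Pβ Pε β≢α ε≢α v≢x vx w≢x xw vw≢α = find (col v w ≟ᶠ β)
    where
    w≢v : w ≢ v
    w≢v = nbr-≢ vx xw ε≢α
    β-nbr≢x : ∀ {t} → col v t ≡ β → t ≢ x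
    β-nbr≢x vt refl = β≢α (trans (sym vt) vx)

    diamond : ∀ {t} → t ≢ v → col v t ≡ β → col x t ≢ ε → col v w ≢ β → Diamond c v x t w
    diamond {t} t≢v vt xt≢ε vw≢β = record
      { a≢b = v≢x ; a≢x = ≢-sym t≢v ; a≢y = ≢-sym w≢v ; b≢x = ≢-sym (β-nbr≢x vt) ; b≢y = ≢-sym w≢x
      ; x≢y = λ { refl → vw≢β vt }
      ; a:bx = differ vx vt (≢-sym β≢α)
      ; a:by = differ′ vx vw≢α
      ; a:xy = differ′ vt vw≢β
      ; b:ax = differ′ (col-flip vx) (private-avoids Pα (≢-sym (β-nbr≢x vt)) (≢-sym v≢x) t≢v)
      ; b:ay = differ (col-flip vx) xw (≢-sym ε≢α)
      ; b:xy = ≢-sym (differ′ xw xt≢ε)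
      ; x:ab = differ′ (col-flip vt) (private-avoids Pβ (β-nbr≢x vt) t≢v (≢-sym v≢x))
      ; y:ab = ≢-sym (differ′ (col-flip xw) (private-avoids Pε w≢v w≢x v≢x)) }

    find : Dec (col v w ≡ β) → Link v x β ε
    find (yes vw≡β) = link w w≢v w≢x vw≡β xw
    find (no vw≢β) with private-edge Pβ
    ... | t , t≢v , vt with col x t ≟ᶠ ε
    ...   | yes xt = link t t≢v (β-nbr≢x vt) vt xt
    ...   | no xt≢ε = ⊥-elim (free (diamond t≢v vt xt≢ε vw≢β))

  -- v and x cannot be linked by β (private at v) together with two distinct colours ε₁, ε₂
  -- private at x: x, t₁ (spine), v, t₂ would span a diamond.
  no-two-links : ∀ {v x α β ε₁ ε₂} → Private v β → Private x ε₁ → Private x ε₂ → col v x ≡ α →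
                 Link v x β ε₁ → Link v x β ε₂ → ε₁ ≢ ε₂ → ε₁ ≢ α → ε₂ ≢ α → β ≢ α → v ≢ x → ⊥
  no-two-links Pβ P₁ P₂ vx (link t₁ t₁≢v t₁≢x vt₁ xt₁) (link t₂ t₂≢v t₂≢x vt₂ xt₂)
               ε₁≢ε₂ ε₁≢α ε₂≢α β≢α v≢x = free record
    { a≢b = ≢-sym t₁≢x ; a≢x = ≢-sym v≢x ; a≢y = ≢-sym t₂≢x ; b≢x = t₁≢v ; b≢y = t₁≢t₂ ; x≢y = ≢-sym t₂≢v
    ; a:bx = differ xt₁ (col-flip vx) ε₁≢α
    ; a:by = differ xt₁ xt₂ ε₁≢ε₂
    ; a:xy = differ (col-flip vx) xt₂ (≢-sym ε₂≢α)
    ; b:ax = differ′ (col-flip xt₁) (private-avoids P₁ t₁≢v t₁≢x v≢x)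
    ; b:ay = differ′ (col-flip xt₁) (private-avoids P₁ t₁≢t₂ t₁≢x t₂≢x)
    ; b:xy = differ′ (col-flip vt₁) (private-avoids Pβ t₁≢t₂ t₁≢v t₂≢v)
    ; x:ab = differ vx vt₁ (≢-sym β≢α)
    ; y:ab = differ′ (col-flip xt₂) (private-avoids P₂ (≢-sym t₁≢t₂) t₂≢x t₁≢x) }
    where
    t₁≢t₂ : t₁ ≢ t₂
    t₁≢t₂ refl = ε₁≢ε₂ (trans (sym xt₁) xt₂)

  -- With vx coloured α and v, x linked by s (colours β at v, ε at x), a colour γ ∉ {α, β}
  -- that avoids everything away from v and x cannot occur at v: v, s (spine), x, w would
  -- span a diamond for any γ-neighbour w of v.
  fresh-colour-excluded : ∀ {v x w α β ε γ} → Private v β → Private x ε → col v x ≡ α →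
                          Link v x β ε → col v w ≡ γ → Avoids v x γ →
                          γ ≢ α → γ ≢ β → β ≢ α → ε ≢ α → v ≢ x → w ≢ v → ⊥
  fresh-colour-excluded {v} {x} {w} {_} {β} {ε} Pβ Pε vx (link s s≢v s≢x vs xs) vw avoids
                        γ≢α γ≢β β≢α ε≢α v≢x w≢v = free record
    { a≢b = ≢-sym s≢v ; a≢x = v≢x ; a≢y = ≢-sym w≢v ; b≢x = s≢x ; b≢y = s≢w ; x≢y = ≢-sym w≢x
    ; a:bx = differ vs vx β≢α
    ; a:by = differ vs vw (≢-sym γ≢β)
    ; a:xy = differ vx vw (≢-sym γ≢α)
    ; b:ax = differ (col-flip vs) (col-flip xs) (≢-sym ε≢β)
    ; b:ay = differ′ (col-flip vs) (private-avoids Pβ s≢w s≢v w≢v)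
    ; b:xy = differ′ (col-flip xs) (private-avoids Pε s≢w s≢x w≢x)
    ; x:ab = differ (col-flip vx) xs (≢-sym ε≢α)
    ; y:ab = differ′ (col-flip vw) (avoids (≢-sym s≢w) w≢v w≢x s≢v s≢x) }
    where
    w≢x : w ≢ x
    w≢x refl = γ≢α (trans (sym vw) vx)
    s≢w : s ≢ w
    s≢w refl = γ≢β (trans (sym vw) vs)
    ε≢β : ε ≢ β
    ε≢β ε≡β = private-avoids Pβ (≢-sym s≢x) (≢-sym v≢x) s≢v (trans xs ε≡β)

  unique-nbr⇒single : ∀ {v x α} → Private v α → x ≢ v → col v x ≡ α →
                      (∀ w → Nbr v α w → w ≡ x) → SingleEdge v x α
  unique-nbr⇒single {v} {x} {α} Pα x≢v vx only-x = ≢-sym x≢v , vx , Pα , proj₁ Pα , at-x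
    where
    at-x : ∀ {i j} → i ≢ j → col i j ≡ α → i ≡ x ⊎ j ≡ x
    at-x i≢j ij≡α with proj₂ Pα i≢j ij≡α
    ... | inj₁ refl = inj₂ (only-x _ (≢-sym i≢j , ij≡α))
    ... | inj₂ refl = inj₁ (only-x _ (i≢j , col-flip ij≡α))

  nested-or-link : ∀ {v x α β ε} → Private v α → Private v β → Private x ε → β ≢ α → ε ≢ α →
                   v ≢ x → col v x ≡ α → (∀ w → Nbr x ε w → Nbr v α w) ⊎ Link v x β ε
  nested-or-link {v} {x} {α} {β} {ε} Pα Pβ Pε β≢α ε≢α v≢x vx
    with any? (λ w → nbr? x ε w ×-dec ¬? (nbr? v α w))
  ... | yes (w , (w≢x , xw) , w∉N) =
    inj₂ (common-neighbour Pα Pβ Pε β≢α ε≢α v≢x vx w≢x xw λ vw → w∉N (nbr-≢ vx xw ε≢α , vw))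
  ... | no none = inj₁ nested
    where
    nested : ∀ w → Nbr x ε w → Nbr v α w
    nested w w∈N with nbr? v α w
    ... | yes w∈N′ = w∈N′
    ... | no w∉N′ = ⊥-elim (none (w , w∈N , w∉N′))

  module _ (two : ∀ v → ∃[ α ] ∃[ β ] (α ≢ β × Private v α × Private v β)) where

    another-private : ∀ v α → ∃[ β ] (β ≢ α × Private v β)
    another-private v α with two v
    ... | α₁ , α₂ , α₁≢α₂ , P₁ , P₂ with α₁ ≟ᶠ α
    ...   | yes refl = α₂ , ≢-sym α₁≢α₂ , P₂
    ...   | no α₁≢α = α₁ , α₁≢α , P₁

    -- Descent on |N(v, α)| for α private at v: pick x ∈ N(v, α). If N(v, α) = {x}, vx is a
    -- single edge. Otherwise the two private colours of x differ from α; they cannot both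
    -- yield links (no-two-links), so one of them has N(x, ε) ⊆ N(v, α), strictly smaller
    -- as x ∈ N(v, α) \ N(x, ε), and we descend to (x, ε).
    single-edge-from : ∀ fuel {v α} → Private v α → count (nbr? v α) ≤ fuel →
                       ∃[ v ] ∃[ x ] ∃[ α ] SingleEdge v x α
    single-edge-from zero {v} {α} Pα bound with private-edge Pα
    ... | x , x≢v , vx = contradiction (≤-trans (count-pos (nbr? v α) x (x≢v , vx)) bound) λ ()
    single-edge-from (suc fuel) {v} {α} Pα bound with private-edge Pα
    ... | x , x≢v , vx with any? (λ w → nbr? v α w ×-dec ¬? (w ≟ᶠ x))
    ...   | no no-other = v , x , α , unique-nbr⇒single Pα x≢v vx only-x
      where
      only-x : ∀ w → Nbr v α w → w ≡ x
      only-x w w∈N with w ≟ᶠ x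
      ... | yes w≡x = w≡x
      ... | no w≢x = ⊥-elim (no-other (w , w∈N , w≢x))
    ...   | yes (x′ , (x′≢v , vx′) , x′≢x) = descend
      where
      -- the α-edge vx′ misses x, so no colour private at x is α
      ≢α : ∀ {ε} → Private x ε → ε ≢ α
      ≢α Pε refl = private-avoids Pε (≢-sym x′≢v) (≢-sym x≢v) x′≢x vx′

      shrink : ∀ {ε} → (∀ w → Nbr x ε w → Nbr v α w) → count (nbr? x ε) ≤ fuel
      shrink {ε} nested =
        ≤-pred (≤-trans (count-< (nbr? x ε) (nbr? v α) nested x (x≢v , vx) λ (x≢x , _) → x≢x refl) bound)

      descend : ∃[ v ] ∃[ x ] ∃[ α ] SingleEdge v x α
      descend with two x | another-private v α
      ... | ε₁ , ε₂ , ε₁≢ε₂ , P₁ , P₂ | β , β≢α , Pβ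
          with nested-or-link Pα Pβ P₁ β≢α (≢α P₁) (≢-sym x≢v) vx
             | nested-or-link Pα Pβ P₂ β≢α (≢α P₂) (≢-sym x≢v) vx
      ...   | inj₁ nested | _ = single-edge-from fuel P₁ (shrink nested)
      ...   | inj₂ _ | inj₁ nested = single-edge-from fuel P₂ (shrink nested)
      ...   | inj₂ l₁ | inj₂ l₂ = ⊥-elim (no-two-links Pβ P₁ P₂ vx l₁ l₂ ε₁≢ε₂ (≢α P₁) (≢α P₂) β≢α (≢-sym x≢v))

    single-edge-exists : Fin m → ∃[ v ] ∃[ x ] ∃[ α ] SingleEdge v x α
    single-edge-exists v with two v
    ... | α , _ , _ , Pα , _ = single-edge-from (count (nbr? v α)) Pα ≤-refl

  single-edge-link : ∀ {v x α β ε} → SingleEdge v x α → Private v β → β ≢ α →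
                     Private x ε → ε ≢ α → Link v x β ε
  single-edge-link (v≢x , vx , Pα , Pα′) Pβ β≢α Pε ε≢α with private-edge Pε
  ... | w , w≢x , xw =
    common-neighbour Pα Pβ Pε β≢α ε≢α v≢x vx w≢x xw (private-avoids Pα′ (≢-sym (nbr-≢ vx xw ε≢α)) v≢x w≢x)

  colours-at-single-edge : ∀ {v x α β ε γ} → SingleEdge v x α → Private v β → β ≢ α →
                           Private x ε → ε ≢ α → Used c γ → Avoids v x γ → γ ∈ α ∷ β ∷ ε ∷ []
  colours-at-single-edge {α = α} {β} {ε} {γ} single@(v≢x , vx , _) Pβ β≢α Pε ε≢α used avoids
    with γ ≟ᶠ α | γ ≟ᶠ β | γ ≟ᶠ ε
  ... | yes γ≡α | _ | _ = here γ≡α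
  ... | no _ | yes γ≡β | _ = there (here γ≡β)
  ... | no _ | no _ | yes γ≡ε = there (there (here γ≡ε))
  ... | no γ≢α | no γ≢β | no γ≢ε
      with avoids-meets used avoids | single-edge-link single Pβ β≢α Pε ε≢α
  ...   | inj₁ (w , w≢v , vw) | linked =
          ⊥-elim (fresh-colour-excluded Pβ Pε vx linked vw avoids γ≢α γ≢β β≢α ε≢α v≢x w≢v)
  ...   | inj₂ (w , w≢x , xw) | linked =
          ⊥-elim (fresh-colour-excluded Pε Pβ (col-flip vx) (link-swap linked) xw (avoids-swap avoids)
                                        γ≢α γ≢ε ε≢α β≢α (≢-sym v≢x) w≢x)

delete : ∀ {n k} → EdgeColoring (suc n) k → Fin (suc n) → EdgeColoring n k
delete c v = record
  { col = λ i j → EdgeColoring.col c (punchIn v i) (punchIn v j)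
  ; sym = λ i j → EdgeColoring.sym c (punchIn v i) (punchIn v j) }

delete-free : ∀ {n k} (c : EdgeColoring (suc n) k) v → DiamondFree c → DiamondFree (delete c v)
delete-free c v free d = free record
  { a≢b = lift a≢b ; a≢x = lift a≢x ; a≢y = lift a≢y ; b≢x = lift b≢x ; b≢y = lift b≢y ; x≢y = lift x≢y
  ; a:bx = a:bx ; a:by = a:by ; a:xy = a:xy ; b:ax = b:ax ; b:ay = b:ay ; b:xy = b:xy
  ; x:ab = x:ab ; y:ab = y:ab }
  where
  open Diamond d
  lift : ∀ {i j} → i ≢ j → punchIn v i ≢ punchIn v j
  lift i≢j = i≢j ∘ punchIn-injective v _ _

survives : ∀ {n} {v i : Fin (suc n)} → i ≢ v → ∃[ i′ ] punchIn v i′ ≡ i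
survives i≢v = punchOut (≢-sym i≢v) , punchIn-punchOut (≢-sym i≢v)

Lost : ∀ {n k} → EdgeColoring (suc n) k → Fin (suc n) → Fin k → Set
Lost c v α = Used c α × ¬ Used (delete c v) α

lost? : ∀ {n k} (c : EdgeColoring (suc n) k) v → Decidable (Lost c v)
lost? c v α = used? c α ×-dec ¬? (used? (delete c v) α)

lost⇒private : ∀ {n k} (c : EdgeColoring (suc n) k) {v α} → Lost c v α → ColourClasses.Private c v α
lost⇒private c {v} {α} (used , gone) = used , at-v
  where
  at-v : ∀ {i j} → i ≢ j → EdgeColoring.col c i j ≡ α → i ≡ v ⊎ j ≡ v
  at-v {i} {j} i≢j ij≡α with i ≟ᶠ v | j ≟ᶠ v
  ... | yes i≡v | _ = inj₁ i≡v
  ... | no _ | yes j≡v = inj₂ j≡v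
  ... | no i≢v | no j≢v with survives i≢v | survives j≢v
  ...   | i′ , refl | j′ , refl = ⊥-elim (gone (i′ , j′ , i≢j ∘ cong (punchIn v) , ij≡α))

colours-delete : ∀ {n k} (c : EdgeColoring (suc n) k) v → #colours c ≤ #colours (delete c v) + count (lost? c v)
colours-delete c v = count-∪ (used? c) (used? (delete c v)) (lost? c v) kept-or-lost
  where
  kept-or-lost : ∀ γ → Used c γ → Used (delete c v) γ ⊎ Lost c v γ
  kept-or-lost γ used with used? (delete c v) γ
  ... | yes kept = inj₁ kept
  ... | no gone = inj₂ (used , gone)

delete-pair : ∀ {n k} → EdgeColoring (suc (suc n)) k → ∀ {v x} → v ≢ x → EdgeColoring n k
delete-pair c {v} v≢x = delete (delete c v) (punchOut v≢x)

survives-pair : ∀ {n} {v x i : Fin (suc (suc n))} (v≢x : v ≢ x) → i ≢ v → i ≢ x →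
                ∃[ i₂ ] punchIn v (punchIn (punchOut v≢x) i₂) ≡ i
survives-pair {v = v} v≢x i≢v i≢x with survives i≢v
... | i₁ , refl with survives (λ i₁≡x′ → i≢x (trans (cong (punchIn v) i₁≡x′) (punchIn-punchOut v≢x)))
...   | i₂ , refl = i₂ , refl

avoids-pair : ∀ {n k} (c : EdgeColoring (suc (suc n)) k) {v x γ} (v≢x : v ≢ x) →
              ¬ Used (delete-pair c v≢x) γ → ColourClasses.Avoids c v x γ
avoids-pair c {v} v≢x gone i≢j i≢v i≢x j≢v j≢x ij≡γ
  with survives-pair v≢x i≢v i≢x | survives-pair v≢x j≢v j≢x
... | i₂ , refl | j₂ , refl = gone (i₂ , j₂ , i≢j ∘ cong (punchIn v ∘ punchIn (punchOut v≢x)) , ij≡γ)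

delete-pair-free : ∀ {n k} (c : EdgeColoring (suc (suc n)) k) {v x} (v≢x : v ≢ x) →
                   DiamondFree c → DiamondFree (delete-pair c v≢x)
delete-pair-free c {v} v≢x free = delete-free (delete c v) (punchOut v≢x) (delete-free c v free)

TwoLost : ∀ {n k} → EdgeColoring (suc n) k → Fin (suc n) → Set
TwoLost c v = ∃[ α ] ∃[ β ] (α ≢ β × Lost c v α × Lost c v β)

two-lost? : ∀ {n k} (c : EdgeColoring (suc n) k) → Decidable (TwoLost c)
two-lost? c v = any? λ α → any? λ β → ¬? (α ≟ᶠ β) ×-dec lost? c v α ×-dec lost? c v β

bound-by-vertex : ∀ {m k} (c : EdgeColoring (suc (suc (suc m))) k) v → ¬ TwoLost c v →
                  #colours (delete c v) ≤ h (suc (suc m)) → #colours c ≤ h (suc (suc (suc m)))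
bound-by-vertex {m} c v not-two ih = begin
  #colours c                                    ≤⟨ colours-delete c v ⟩
  #colours (delete c v) + count (lost? c v)     ≤⟨ +-mono-≤ ih (count-≤1 (lost? c v) at-most-one) ⟩
  h (suc (suc m)) + 1                           ≡⟨ +-comm (h (suc (suc m))) 1 ⟩
  suc (h (suc (suc m)))                         ≤⟨ h-strict (suc m) ⟩
  h (suc (suc (suc m)))                         ∎
  where
  open ≤-Reasoning
  at-most-one : ∀ α β → Lost c v α → Lost c v β → α ≡ β
  at-most-one α β lost-α lost-β with α ≟ᶠ β
  ... | yes α≡β = α≡β
  ... | no α≢β = ⊥-elim (not-two (α , β , α≢β , lost-α , lost-β))

bound-by-single-edge : ∀ {m k} (c : EdgeColoring (suc (suc (suc m))) k) → DiamondFree c →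
                       (∀ v → TwoLost c v) →
                       (∀ {v x} (v≢x : v ≢ x) → #colours (delete-pair c v≢x) ≤ h (suc m)) →
                       #colours c ≤ h (suc (suc (suc m)))
bound-by-single-edge {m} c free all-two ih = bound (single-edge-exists two zero)
  where
  open DiamondFreeColouring c free
  open ColourClasses c using (SingleEdge)

  two : ∀ v → ∃[ α ] ∃[ β ] (α ≢ β × ColourClasses.Private c v α × ColourClasses.Private c v β)
  two v with all-two v
  ... | α , β , α≢β , lost-α , lost-β = α , β , α≢β , lost⇒private c lost-α , lost⇒private c lost-β

  bound : ∃[ v ] ∃[ x ] ∃[ α ] SingleEdge v x α → #colours c ≤ h (suc (suc (suc m)))
  bound (v , x , α , single@(v≢x , _)) with another-private two v α | another-private two x α
  ... | β , β≢α , Pβ | ε , ε≢α , Pε = begin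
    #colours c                                       ≤⟨ count-∪ (used? c) (used? (delete-pair c v≢x)) near? kept-or-near ⟩
    #colours (delete-pair c v≢x) + count near?       ≤⟨ +-mono-≤ (ih v≢x) (count-∈ (α ∷ β ∷ ε ∷ [])) ⟩
    h (suc m) + 3                                    ≡⟨ +-comm (h (suc m)) 3 ⟩
    h (suc (suc (suc m)))                            ∎
    where
    open ≤-Reasoning
    near? : Decidable (_∈ α ∷ β ∷ ε ∷ [])
    near? = member? (α ∷ β ∷ ε ∷ [])
    kept-or-near : ∀ γ → Used c γ → Used (delete-pair c v≢x) γ ⊎ γ ∈ α ∷ β ∷ ε ∷ []
    kept-or-near γ used with used? (delete-pair c v≢x) γ
    ... | yes kept = inj₁ kept
    ... | no gone = inj₂ (colours-at-single-edge single Pβ β≢α Pε ε≢α used (avoids-pair c v≢x gone))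

colour-bound : ∀ n {k} (c : EdgeColoring n k) → DiamondFree c → #colours c ≤ h n
colour-bound zero c _ = ≤-reflexive (count-none (used? c) λ { _ (() , _) })
colour-bound (suc zero) c _ = ≤-reflexive (count-none (used? c) λ { _ (zero , zero , 0≢0 , _) → 0≢0 refl })
colour-bound (suc (suc zero)) c _ = count-≤1 (used? c) λ γ δ used-γ used-δ → trans (sym (edge used-γ)) (edge used-δ)
  where
  open EdgeColoring c using (col) renaming (sym to col-sym)
  edge : ∀ {γ} → Used c γ → col zero (suc zero) ≡ γ
  edge (zero , zero , 0≢0 , _) = ⊥-elim (0≢0 refl)
  edge (zero , suc zero , _ , e) = e
  edge (suc zero , zero , _ , e) = trans (col-sym zero (suc zero)) e
  edge (suc zero , suc zero , 1≢1 , _) = ⊥-elim (1≢1 refl)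
colour-bound (suc (suc (suc m))) c free
  with all? (two-lost? c) | colour-bound (suc m) | colour-bound (suc (suc m))
... | yes all-two | bound-m+1 | _ =
  bound-by-single-edge c free all-two λ v≢x → bound-m+1 (delete-pair c v≢x) (delete-pair-free c v≢x free)
... | no not-all | _ | bound-m+2 with ¬∀⟶∃¬ _ (TwoLost c) (two-lost? c) not-all
...   | v , not-two = bound-by-vertex c v not-two (bound-m+2 (delete c v) (delete-free c v free))

pr-K4⁻ : ∀ n → 2 ≤ n → PrK4⁻ n (h n)
pr-K4⁻ n 2≤n = (colouring , all-colours , no-copy) , upper
  where
  open ExtremalColouring n 2≤n
  no-copy : ¬ PCCopyK4⁻ colouring
  no-copy copy with copy⇒diamond colouring copy
  ... | _ , _ , _ , _ , d = diamond-free d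
  upper : ∀ k → Admissible n k → k ≤ h n
  upper k (c , all , no-copy′) =
    subst (_≤ h n) (count-all (used? c) all) (colour-bound n c λ d → no-copy′ (diamond⇒copy c d))

theorem5 : ∀ (n : ℕ) → 4 ≤ n → PrK4⁻ n ((3 * (n ∸ 1)) / 2)
theorem5 n 4≤n = subst (PrK4⁻ n) (h-formula n) (pr-K4⁻ n (≤-trans (s≤s (s≤s z≤n)) 4≤n))
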